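{- The function $\mathcal D$ from simple propositions to dualizing graphs is a surjection: every dualizing graph equals $\mathcal D(\varphi)$ for some simple proposition $\varphi$.
   Context: Simple propositions are built from nullary predicate symbols (each $p$ with a dual $\bar p\neq p$, $\bar{\bar p}=p$) by $\wedge,\vee$, with no constants $1,0$. A cograph is a graph with no induced four-vertex path. A dualizing graph is a nonempty cograph $(V,E)$ with a second set $\Delta$ of undirected edges on $V$ (dualities) such that $(V,\Delta)$ is a cograph with no triangle; dualizing graphs are identified up to isomorphism. $\mathcal D(\varphi)$ has as vertices the occurrences of predicate symbols in $\varphi$, an edge $vw$ iff the smallest subformula containing $v$ and $w$ is a conjunction, and a duality $vw$ iff $v,w$ have dual predicate symbols. -}

module Defs where

open import Data.Nat using (ℕ; _+_; _<_; _≟_)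
open import Data.Bool using (Bool; true; false; not; T)
import Data.Bool as B
open import Data.Fin using (Fin; splitAt)
open import Data.Sum using (_⊎_; inj₁; inj₂; [_,_])
open import Data.Product using (_×_; _,_; proj₁; proj₂; Σ)
open import Data.Product.Properties using (≡-dec)
open import Relation.Nullary using (¬_)
open import Relation.Nullary.Decidable using (⌊_⌋)
open import Relation.Binary.PropositionalEquality using (_≡_)
open import Function.Bundles using (_⤖_; Bijection)

-- Predicate symbols: a countably infinite supply with a fixed-point-free
-- involution  p ↦ p̄.  Symbol (k , b) has dual (k , not b).

Pred : Set
Pred = ℕ × Bool

dual : Pred → Pred
dual (k , b) = (k , not b)

_≟P_ : (p q : Pred) → Relation.Nullary.Dec (p ≡ q)
_≟P_ = ≡-dec _≟_ B._≟_

data Prop : Set where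
  atom : Pred → Prop
  _∧_  : Prop → Prop → Prop
  _∨_  : Prop → Prop → Prop

size : Prop → ℕ
size (atom p) = 1
size (φ ∧ ψ)  = size φ + size ψ
size (φ ∨ ψ)  = size φ + size ψ

-- the predicate symbol at each occurrence (occurrences numbered left to right)
label : (φ : Prop) → Fin (size φ) → Pred
label (atom p) _ = p
label (φ ∧ ψ) i = [ label φ , label ψ ] (splitAt (size φ) i)
label (φ ∨ ψ) i = [ label φ , label ψ ] (splitAt (size φ) i)

-- conj φ v w = true iff the smallest subformula of φ containing the
-- occurrences v and w is a conjunction
conj : (φ : Prop) → Fin (size φ) → Fin (size φ) → Bool
conjBin : Bool → (φ ψ : Prop) → Fin (size φ) ⊎ Fin (size ψ) → Fin (size φ) ⊎ Fin (size ψ) → Bool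

conj (atom p) _ _ = false
conj (φ ∧ ψ) i j = conjBin true  φ ψ (splitAt (size φ) i) (splitAt (size φ) j)
conj (φ ∨ ψ) i j = conjBin false φ ψ (splitAt (size φ) i) (splitAt (size φ) j)

conjBin b φ ψ (inj₁ x) (inj₁ y) = conj φ x y
conjBin b φ ψ (inj₂ x) (inj₂ y) = conj ψ x y
conjBin b φ ψ (inj₁ x) (inj₂ y) = b
conjBin b φ ψ (inj₂ x) (inj₁ y) = b

record RawDG : Set where
  field
    n : ℕ
    E : Fin n → Fin n → Bool
    Δ : Fin n → Fin n → Bool

Symmetric : {n : ℕ} → (Fin n → Fin n → Bool) → Set
Symmetric R = ∀ a b → R a b ≡ R b a

Irreflexive : {n : ℕ} → (Fin n → Fin n → Bool) → Set
Irreflexive R = ∀ a → R a a ≡ false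

Cograph : {n : ℕ} → (Fin n → Fin n → Bool) → Set
Cograph R = ∀ a b c d →
  ¬ (T (R a b) × T (R b c) × T (R c d) ×
     ¬ T (R a c) × ¬ T (R b d) × ¬ T (R a d))

TriangleFree : {n : ℕ} → (Fin n → Fin n → Bool) → Set
TriangleFree R = ∀ a b c → ¬ (T (R a b) × T (R b c) × T (R a c))

record IsDualizingGraph (G : RawDG) : Set where
  open RawDG G
  field
    nonempty     : 0 < n
    E-sym        : Symmetric E
    E-irrefl     : Irreflexive E
    E-cograph    : Cograph E
    Δ-sym        : Symmetric Δ
    Δ-irrefl     : Irreflexive Δ
    Δ-cograph    : Cograph Δ
    Δ-triangleFree : TriangleFree Δ

DualizingGraph : Set
DualizingGraph = Σ RawDG IsDualizingGraph

record _≅_ (G H : RawDG) : Set where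
  private
    module G = RawDG G
    module H = RawDG H
  field
    iso    : Fin G.n ⤖ Fin H.n
  f : Fin G.n → Fin H.n
  f = Bijection.to iso
  field
    pres-E : ∀ a b → H.E (f a) (f b) ≡ G.E a b
    pres-Δ : ∀ a b → H.Δ (f a) (f b) ≡ G.Δ a b

𝒟 : Prop → RawDG
𝒟 φ = record
  { n = size φ
  ; E = conj φ
  ; Δ = λ v w → ⌊ label φ v ≟P dual (label φ w) ⌋
  }

module Submission where

-- Let G = (V , E , Δ). The shape of φ comes from E, its predicate symbols
-- from Δ.
--  * Edges. A cograph on at least two vertices has a split: a two-colouring
--    of its vertices, both colours used, with either all or no edges between
--    the colours (`cographSplit`, by induction on the vertex list; the new
--    vertex v is handled by noting that in a cograph the vertices within
--    distance two of v are closed under adjacency). Splitting recursively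
--    gives φ whose occurrences correspond to V, a split with all cross edges
--    becoming ∧ and one with none becoming ∨ (`realise`).
--  * Dualities. In a triangle-free cograph every path a – b – c – d closes
--    to an edge a – d, so every component is an isolated vertex or complete
--    bipartite. Naming a component by its least vertex and tagging its two
--    sides by opposite Booleans gives lab : V → Pred with
--    lab a ≡ dual (lab b) exactly when a and b are dual (`labelling-exact`).
-- Labelling every occurrence of φ by lab of its vertex yields G ≅ 𝒟 φ.

open import Defs
open import Data.Product using (Σ; proj₁)
open import Data.Product using (_×_; _,_; proj₂; ∃)
open import Data.Nat using (ℕ; zero; suc; _+_; _<_; _<?_)
open import Data.Nat.Properties using (≮⇒≥; ≤-antisym; <-asym)
open import Data.Nat.Induction using (<-wellFounded)
open import Induction.WellFounded using (Acc; acc)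
open import Data.Fin using (Fin; zero; suc; toℕ; splitAt; join; fromℕ<; _≟_)
open import Data.Fin.Properties using (toℕ-injective; splitAt-join; join-splitAt)
open import Data.Bool using (Bool; true; false; not; T; if_then_else_)
open import Data.Bool.Properties using (not-¬; not-involutive) renaming (_≟_ to _≟ᵇ_)
open import Data.Maybe using (Maybe; just; nothing)
import Data.Maybe as Maybe
open import Data.Sum using (_⊎_; inj₁; inj₂; [_,_])
open import Data.List using (List; []; _∷_; length; filter; allFin)
open import Data.List.Properties using (filter-notAll)
open import Data.List.Membership.Propositional using (_∈_; _∉_; find; lose)
open import Data.List.Membership.Propositional.Properties using (∈-filter⁺; ∈-filter⁻; ∈-allFin)
open import Data.List.Relation.Unary.Any using (Any; here; there; any?)
open import Data.List.Relation.Unary.All using (All; all?)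
import Data.List.Relation.Unary.All as All
open import Data.List.Relation.Unary.All.Properties using (¬All⇒Any¬; All¬⇒¬Any)
open import Data.List.Relation.Unary.AllPairs using (_∷_)
open import Data.List.Relation.Unary.Unique.Propositional using (Unique)
open import Data.List.Relation.Unary.Unique.Propositional.Properties using (filter⁺; allFin⁺)
open import Data.Empty using (⊥; ⊥-elim)
open import Data.Unit using (tt)
open import Function using (_∘_)
open import Function.Bundles using (mk⤖)
open import Relation.Nullary using (¬_; Dec; yes; no; does)
open import Relation.Nullary.Decidable using (⌊_⌋; dec-true; dec-false; _⊎-dec_; _×-dec_)
open import Relation.Binary.PropositionalEquality
  using (_≡_; _≢_; refl; sym; trans; cong; cong₂; subst; module ≡-Reasoning)

true≢false : true ≢ false
true≢false ()

not-flip : ∀ {x c} → not x ≡ c → x ≡ not c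
not-flip {true} refl = refl
not-flip {false} refl = refl

Rel : ℕ → Set
Rel n = Fin n → Fin n → Bool

NoP4 : ∀ {n} → Rel n → Set
NoP4 R = ∀ {a b c d} → R a b ≡ true → R b c ≡ true → R c d ≡ true →
         R a c ≡ false → R b d ≡ false → R a d ≡ false → ⊥

NoTriangle : ∀ {n} → Rel n → Set
NoTriangle R = ∀ {a b c} → R a b ≡ true → R b c ≡ true → R a c ≡ true → ⊥

true⇒T : ∀ {x} → x ≡ true → T x
true⇒T refl = tt

false⇒¬T : ∀ {x} → x ≡ false → ¬ T x
false⇒¬T refl ()

cograph⇒noP4 : ∀ {n} {R : Rel n} → Cograph R → NoP4 R
cograph⇒noP4 cograph ab bc cd ac bd ad =
  cograph _ _ _ _ (true⇒T ab , true⇒T bc , true⇒T cd , false⇒¬T ac , false⇒¬T bd , false⇒¬T ad)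

triangleFree⇒noTriangle : ∀ {n} {R : Rel n} → TriangleFree R → NoTriangle R
triangleFree⇒noTriangle triangleFree ab bc ac = triangleFree _ _ _ (true⇒T ab , true⇒T bc , true⇒T ac)

complement : ∀ {n} → Rel n → Rel n
complement R a b = not (R a b)

complement-sym : ∀ {n} {R : Rel n} → Symmetric R → Symmetric (complement R)
complement-sym R-sym a b = cong not (R-sym a b)

-- The complement of an induced path a – b – c – d is the induced path
-- b – d – a – c, so the complement of a cograph is a cograph.
complement-noP4 : ∀ {n} {R : Rel n} → Symmetric R → NoP4 R → NoP4 (complement R)
complement-noP4 {R = R} R-sym noP4 {a} {b} {c} {d} ab bc cd ac bd ad =
  noP4 {b} {d} {a} {c} (not-flip bd) (trans (R-sym d a) (not-flip ad)) (not-flip ac)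
       (trans (R-sym b a) (not-flip ab)) (trans (R-sym d c) (not-flip cd)) (not-flip bc)

record Split {n} (R : Rel n) (S : List (Fin n)) : Set where
  field
    part    : Fin n → Bool
    inhabit : ∀ c → ∃ λ x → x ∈ S × part x ≡ c
    between : Bool
    uniform : ∀ {x y} → x ∈ S → y ∈ S → part x ≢ part y → R x y ≡ between

open Split

flipSplit : ∀ {n} {R R' : Rel n} {S} → (∀ x y → R' x y ≡ not (R x y)) → Split R S → Split R' S
flipSplit opposite sp = record
  { part = part sp ; inhabit = inhabit sp ; between = not (between sp)
  ; uniform = λ x∈ y∈ ne → trans (opposite _ _) (cong not (uniform sp x∈ y∈ ne)) }

isolate : ∀ {n} {R : Rel n} {v w S b} → Symmetric R → v ∉ S → w ∈ S →
          (∀ {x} → x ∈ S → R v x ≡ b) → Split R (v ∷ S)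
isolate {R = R} {v} {w} {S} {b} R-sym v∉S w∈S v-uniform = record
  { part = isV
  ; inhabit = λ { true  → v , here refl , dec-true (v ≟ v) refl
                ; false → w , there w∈S , notV w∈S }
  ; between = b
  ; uniform = across }
  where
  isV : Fin _ → Bool
  isV x = does (x ≟ v)

  notV : ∀ {x} → x ∈ S → isV x ≡ false
  notV x∈S = dec-false (_ ≟ v) (λ x≡v → v∉S (subst (_∈ S) x≡v x∈S))

  across : ∀ {x y} → x ∈ v ∷ S → y ∈ v ∷ S → isV x ≢ isV y → R x y ≡ b
  across (here refl)  (here refl)  ne = ⊥-elim (ne refl)
  across (here refl)  (there y∈S) _  = v-uniform y∈S
  across (there x∈S) (here refl)  _  = trans (R-sym _ v) (v-uniform x∈S)
  across (there x∈S) (there y∈S) ne = ⊥-elim (ne (trans (notV x∈S) (sym (notV y∈S))))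

-- The vertices reachable from v by a path of length at most two through S.
-- In a cograph they are closed under adjacency: for a path v – z – x – y
-- with v, x not adjacent, avoiding the P₄ forces z – y or v – y.
module Near {n} {R : Rel n} (R-sym : Symmetric R) (noP4 : NoP4 R) (v : Fin n) (S : List (Fin n)) where

  Near : Fin n → Set
  Near x = x ≡ v ⊎ R v x ≡ true ⊎ Any (λ y → R v y ≡ true × R y x ≡ true) S

  near? : ∀ x → Dec (Near x)
  near? x = x ≟ v ⊎-dec R v x ≟ᵇ true ⊎-dec any? (λ y → R v y ≟ᵇ true ×-dec R y x ≟ᵇ true) S

  near-via : ∀ {x y} → x ∈ v ∷ S → R v x ≡ true → R x y ≡ true → Near y
  near-via (here refl) _  vy = inj₂ (inj₁ vy)
  near-via (there x∈S) vx xy = inj₂ (inj₂ (lose x∈S (vx , xy)))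

  near-closed : ∀ {x y} → x ∈ v ∷ S → Near x → R x y ≡ true → Near y
  near-closed _  (inj₁ refl)         vy = inj₂ (inj₁ vy)
  near-closed x∈ (inj₂ (inj₁ vx))    xy = near-via x∈ vx xy
  near-closed {x} {y} x∈ (inj₂ (inj₂ path)) xy with find path
  ... | z , z∈S , vz , zx with R v x in vx
  ...   | true  = near-via x∈ vx xy
  ...   | false with R v y in vy | R z y in zy
  ...     | true  | _     = inj₂ (inj₁ refl)
  ...     | false | true  = inj₂ (inj₂ (lose z∈S (vz , zy)))
  ...     | false | false = ⊥-elim (noP4 vz zx xy vx zy vy)

module Extend {n} {R : Rel n} (R-sym : Symmetric R) (noP4 : NoP4 R) {v : Fin n} {S' : List (Fin n)}
              (v∉S' : v ∉ S') (sp : Split R S') (no-cross : between sp ≡ false) where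

  open Near R-sym noP4 v S'

  same-part : ∀ {x y} → x ∈ S' → y ∈ S' → R x y ≡ true → part sp x ≡ part sp y
  same-part {x} {y} x∈ y∈ xy with part sp x ≟ᵇ part sp y
  ... | yes same = same
  ... | no differ = ⊥-elim (true≢false (trans (sym xy) (trans (uniform sp x∈ y∈ differ) no-cross)))

  neighbour-of-colour : All Near S' → ∀ c → ∃ λ z → z ∈ S' × R v z ≡ true × part sp z ≡ c
  neighbour-of-colour near c with inhabit sp c
  ... | z , z∈ , zc with All.lookup near z∈
  ...   | inj₁ refl = ⊥-elim (v∉S' z∈)
  ...   | inj₂ (inj₁ vz) = z , z∈ , vz , zc
  ...   | inj₂ (inj₂ path) with find path
  ...     | y , y∈ , vy , yz = y , y∈ , vy , trans (same-part y∈ z∈ yz) zc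

  -- If all of S' is near v then v is adjacent to all of S': for a
  -- non-neighbour x, a path v – y – x and a neighbour z of v of the other
  -- colour, x – y – v – z would be an induced P₄.
  adjacent-to-all : All Near S' → ∀ {x} → x ∈ S' → R v x ≡ true
  adjacent-to-all near {x} x∈ with R v x in vx
  ... | true = refl
  ... | false with All.lookup near x∈ | neighbour-of-colour near (not (part sp x))
  ...   | inj₁ refl        | _ = ⊥-elim (v∉S' x∈)
  ...   | inj₂ (inj₁ vx')  | _ = ⊥-elim (true≢false (trans (sym vx') vx))
  ...   | inj₂ (inj₂ path) | z , z∈ , vz , zc with find path
  ...     | y , y∈ , vy , yx =
    ⊥-elim (noP4 {x} {y} {v} {z} (trans (R-sym x y) yx) (trans (R-sym y v) vy) vz
                 (trans (R-sym x v) vx) (no-edge y∈ z∈ y≢z) (no-edge x∈ z∈ x≢z))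
    where
    no-edge : ∀ {a b} → a ∈ S' → b ∈ S' → part sp a ≢ part sp b → R a b ≡ false
    no-edge a∈ b∈ differ = trans (uniform sp a∈ b∈ differ) no-cross

    x≢z : part sp x ≢ part sp z
    x≢z e = not-¬ refl (trans e zc)

    y≢z : part sp y ≢ part sp z
    y≢z e = x≢z (trans (same-part x∈ y∈ (trans (R-sym x y) yx)) e)

  separate-near : (∃ λ y → y ∈ S' × ¬ Near y) → Split R (v ∷ S')
  separate-near (y , y∈ , far) = record
    { part = λ x → does (near? x)
    ; inhabit = λ { true  → v , here refl , dec-true (near? v) (inj₁ refl)
                  ; false → y , there y∈ , dec-false (near? y) far }
    ; between = false
    ; uniform = across }
    where
    across : ∀ {a b} → a ∈ v ∷ S' → b ∈ v ∷ S' → does (near? a) ≢ does (near? b) → R a b ≡ false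
    across {a} {b} a∈ b∈ differ with R a b in ab | near? a | near? b
    ... | false | _        | _        = refl
    ... | true  | yes near | no far'  = ⊥-elim (far' (near-closed a∈ near ab))
    ... | true  | no far'  | yes near = ⊥-elim (far' (near-closed b∈ near (trans (R-sym b a) ab)))
    ... | true  | yes na   | yes nb   = ⊥-elim (differ (trans (dec-true (near? a) na) (sym (dec-true (near? b) nb))))
    ... | true  | no fa    | no fb    = ⊥-elim (differ (trans (dec-false (near? a) fa) (sym (dec-false (near? b) fb))))

  extend : Split R (v ∷ S')
  extend with all? near? S'
  ... | yes near = isolate R-sym v∉S' (proj₁ (proj₂ (inhabit sp true))) (adjacent-to-all near)
  ... | no ¬near = separate-near (find (¬All⇒Any¬ near? S' ¬near))

-- Every cograph on at least two vertices has a split. By induction on the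
-- vertex list; a split with all cross edges is handled in the complement.
cographSplit : ∀ {n} {R : Rel n} → Symmetric R → NoP4 R →
               ∀ {v w rest} → Unique (v ∷ w ∷ rest) → Split R (v ∷ w ∷ rest)
cographSplit R-sym noP4 {rest = []} (v∉ ∷ _) =
  isolate R-sym (All¬⇒¬Any v∉) (here refl) λ { (here refl) → refl ; (there ()) }
cographSplit {R = R} R-sym noP4 {rest = _ ∷ _} (v∉ ∷ distinct)
  with cographSplit R-sym noP4 distinct
... | sp with between sp in cross
...   | false = Extend.extend R-sym noP4 (All¬⇒¬Any v∉) sp cross
...   | true  = flipSplit (λ x y → sym (not-involutive (R x y)))
                  (Extend.extend (complement-sym R-sym) (complement-noP4 R-sym noP4) (All¬⇒¬Any v∉)
                                 (flipSplit (λ _ _ → refl) sp) (cong not cross))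

module _ {n} {R : Rel n} {S : List (Fin n)} (sp : Split R S) where

  side : Bool → List (Fin n)
  side c = filter (λ x → part sp x ≟ᵇ c) S

  ∈-side⁺ : ∀ {c x} → x ∈ S → part sp x ≡ c → x ∈ side c
  ∈-side⁺ {c} = ∈-filter⁺ (λ x → part sp x ≟ᵇ c)

  ∈-side⁻ : ∀ {c x} → x ∈ side c → x ∈ S × part sp x ≡ c
  ∈-side⁻ {c} = ∈-filter⁻ (λ x → part sp x ≟ᵇ c)

  side-inhabited : ∀ c → ∃ (_∈ side c)
  side-inhabited c with inhabit sp c
  ... | x , x∈ , xc = x , ∈-side⁺ x∈ xc

  side-shorter : ∀ c → length (side c) < length S
  side-shorter c with inhabit sp (not c)
  ... | y , y∈ , yc = filter-notAll (λ x → part sp x ≟ᵇ c) S (lose y∈ λ e → not-¬ refl (trans (sym e) yc))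

  side-unique : Unique S → ∀ c → Unique (side c)
  side-unique distinct c = filter⁺ (λ x → part sp x ≟ᵇ c) distinct


search : ∀ {n} → (Fin n → Bool) → Maybe (Fin n)
search {zero} p = nothing
search {suc n} p = if p zero then just zero else Maybe.map suc (search (p ∘ suc))

search-ext : ∀ {n} {p q : Fin n → Bool} → (∀ i → p i ≡ q i) → search p ≡ search q
search-ext {zero} _ = refl
search-ext {suc n} {p} {q} p≗q rewrite p≗q zero with q zero
... | true  = refl
... | false = cong (Maybe.map suc) (search-ext (p≗q ∘ suc))

search-just : ∀ {n} (p : Fin n → Bool) {i} → search p ≡ just i → p i ≡ true
search-just {suc n} p eq with p zero in p0 | search (p ∘ suc) in rest
search-just {suc n} p refl | true  | _      = p0
search-just {suc n} p refl | false | just i = search-just (p ∘ suc) rest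

search-nothing : ∀ {n} (p : Fin n → Bool) → search p ≡ nothing → ∀ i → p i ≡ false
search-nothing {suc n} p eq i with p zero in p0 | search (p ∘ suc) in rest
search-nothing {suc n} p ()   i       | true  | _
search-nothing {suc n} p ()   i       | false | just _
search-nothing {suc n} p refl zero    | false | nothing = p0
search-nothing {suc n} p refl (suc i) | false | nothing = search-nothing (p ∘ suc) rest i

-- The name of a complete bipartite component whose sides have least
-- vertices o and m: the smaller index, tagged by whether it is m.
key : ∀ {n} → Fin n → Fin n → Pred
key o m with toℕ m <? toℕ o
... | yes _ = (toℕ m , true)
... | no  _ = (toℕ o , false)

key-antisym : ∀ {n} {o m : Fin n} → o ≢ m → key o m ≡ dual (key m o)
key-antisym {o = o} {m} o≢m with toℕ m <? toℕ o | toℕ o <? toℕ m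
... | yes m<o | yes o<m = ⊥-elim (<-asym m<o o<m)
... | yes _   | no _    = refl
... | no _    | yes _   = refl
... | no m≮o  | no o≮m = ⊥-elim (o≢m (toℕ-injective (≤-antisym (≮⇒≥ m≮o) (≮⇒≥ o≮m))))

key-dual⁻¹ : ∀ {n} {o m o' m' : Fin n} → key o m ≡ dual (key o' m') → m ≡ o' ⊎ o ≡ m'
key-dual⁻¹ {o = o} {m} {o'} {m'} eq with toℕ m <? toℕ o | toℕ m' <? toℕ o'
... | yes _ | yes _ = ⊥-elim (true≢false (cong proj₂ eq))
... | yes _ | no _  = inj₁ (toℕ-injective (cong proj₁ eq))
... | no _  | yes _ = inj₂ (toℕ-injective (cong proj₁ eq))
... | no _  | no _  = ⊥-elim (true≢false (sym (cong proj₂ eq)))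

key-name : ∀ {n} {a o m : Fin n} → toℕ a ≡ proj₁ (key o m) → a ≡ o ⊎ a ≡ m
key-name {o = o} {m} eq with toℕ m <? toℕ o
... | yes _ = inj₂ (toℕ-injective eq)
... | no _  = inj₁ (toℕ-injective eq)

name-dual : ∀ p → proj₁ (dual p) ≡ proj₁ p
name-dual (k , b) = refl

module Labelling {n} (D : Rel n) (D-sym : Symmetric D) (D-irrefl : Irreflexive D)
                 (noP4 : NoP4 D) (noTriangle : NoTriangle D) where

  flip : ∀ {a b} → D a b ≡ true → D b a ≡ true
  flip {a} {b} ab = trans (D-sym b a) ab

  -- Every path a – b – c – d closes: a – c or b – d would close a triangle,
  -- and otherwise a – d avoids an induced P₄.
  close-path : ∀ {a b c d} → D a b ≡ true → D b c ≡ true → D c d ≡ true → D a d ≡ true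
  close-path {a} {b} {c} {d} ab bc cd with D a d in ad | D a c in ac | D b d in bd
  ... | true  | _     | _     = refl
  ... | false | true  | _     = ⊥-elim (noTriangle ab bc ac)
  ... | false | false | true  = ⊥-elim (noTriangle bc cd bd)
  ... | false | false | false = ⊥-elim (noP4 ab bc cd ac bd ad)

  same-neighbours : ∀ {a b c} → D a c ≡ true → D b c ≡ true → ∀ w → D a w ≡ D b w
  same-neighbours {a} {b} ac bc w with D a w in aw | D b w in bw
  ... | true  | true  = refl
  ... | false | false = refl
  ... | true  | false = ⊥-elim (true≢false (trans (sym (close-path bc (flip ac) aw)) bw))
  ... | false | true  = ⊥-elim (true≢false (trans (sym (close-path ac (flip bc) bw)) aw))

  neighbour : Fin n → Maybe (Fin n)
  neighbour a = search (D a)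

  neighbour-adjacent : ∀ {a o} → neighbour a ≡ just o → D a o ≡ true
  neighbour-adjacent {a} = search-just (D a)

  no-neighbour : ∀ {a} → neighbour a ≡ nothing → ∀ w → D a w ≡ false
  no-neighbour {a} = search-nothing (D a)

  same-neighbour : ∀ {a b c} → D a c ≡ true → D b c ≡ true → neighbour a ≡ neighbour b
  same-neighbour ac bc = search-ext (same-neighbours ac bc)

  -- An isolated vertex a is named (a , true). Otherwise let o be the first
  -- neighbour of a and m the first neighbour of o, so m is the least vertex
  -- on a's side and o the least on the other; a is named key o m.
  lab : Fin n → Pred
  lab a with neighbour a
  ... | nothing = (toℕ a , true)
  ... | just o with neighbour o
  ...   | just m  = key o m
  ...   | nothing = (toℕ a , true)   -- unreachable, see `position`

  lab-isolated : ∀ {a} → neighbour a ≡ nothing → lab a ≡ (toℕ a , true)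
  lab-isolated fa rewrite fa = refl

  lab-paired : ∀ {a o m} → neighbour a ≡ just o → neighbour o ≡ just m → lab a ≡ key o m
  lab-paired fa fo rewrite fa | fo = refl

  -- How the name of a was chosen; the second search always succeeds, as a
  -- is a neighbour of o.
  data Position (a : Fin n) : Set where
    isolated : neighbour a ≡ nothing → lab a ≡ (toℕ a , true) → Position a
    paired   : ∀ {o m} → neighbour a ≡ just o → neighbour o ≡ just m → lab a ≡ key o m → Position a

  position : ∀ a → Position a
  position a with neighbour a in fa
  ... | nothing = isolated fa (lab-isolated fa)
  ... | just o with neighbour o in fo
  ...   | just m  = paired fa fo (lab-paired fa fo)
  ...   | nothing = ⊥-elim (true≢false (trans (sym (flip (neighbour-adjacent fa))) (no-neighbour fo a)))

  -- An isolated vertex a shares its index with no name of a paired vertex,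
  -- since such a name is the index of a vertex with a neighbour.
  isolated-unnamed : ∀ {a o m} → neighbour a ≡ nothing → neighbour o ≡ just m →
                     toℕ a ≡ proj₁ (key o m) → ⊥
  isolated-unnamed {o = o} {m} fa fo eq with key-name {o = o} {m} eq
  ... | inj₁ refl = true≢false (trans (sym (neighbour-adjacent fo)) (no-neighbour fa _))
  ... | inj₂ refl = true≢false (trans (sym (flip (neighbour-adjacent fo))) (no-neighbour fa _))

  adjacent-distinct : ∀ {a b} → D a b ≡ true → a ≢ b
  adjacent-distinct ab refl = true≢false (trans (sym ab) (D-irrefl _))

  -- Dual vertices a, b get dual names: b's first neighbour is the first
  -- neighbour m of o (as b and o share the neighbour a), and symmetrically,
  -- so lab b ≡ key m o.
  adjacent⇒dual : ∀ {a b} → D a b ≡ true → lab a ≡ dual (lab b)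
  adjacent⇒dual {a} {b} ab with position a | position b
  ... | isolated fa _ | _ = ⊥-elim (true≢false (trans (sym ab) (no-neighbour fa b)))
  ... | paired _ _ _  | isolated fb _ = ⊥-elim (true≢false (trans (sym (flip ab)) (no-neighbour fb a)))
  ... | paired {o} {m} fa fo la | paired {o'} {m'} fb fo' lb
    with trans (sym fb) (trans (same-neighbour (flip ab) (flip (neighbour-adjacent fa))) fo)
       | trans (sym fa) (trans (same-neighbour ab (flip (neighbour-adjacent fb))) fo')
  ... | refl | refl = begin
    lab a              ≡⟨ la ⟩
    key o m            ≡⟨ key-antisym (adjacent-distinct (neighbour-adjacent fo)) ⟩
    dual (key m o)     ≡⟨ cong dual (sym lb) ⟩
    dual (lab b)       ∎
    where open ≡-Reasoning

  -- Vertices with dual names are dual: the names share a vertex, which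
  -- links a and b by a path of length three.
  dual⇒adjacent : ∀ {a b} → lab a ≡ dual (lab b) → D a b ≡ true
  dual⇒adjacent {a} {b} eq with position a | position b
  ... | isolated _ la | isolated _ lb =
    ⊥-elim (true≢false (cong proj₂ (trans (sym la) (trans eq (cong dual lb)))))
  ... | isolated fa la | paired {o'} {m'} _ fo' lb =
    ⊥-elim (isolated-unnamed fa fo'
      (trans (cong proj₁ (trans (sym la) (trans eq (cong dual lb)))) (name-dual (key o' m'))))
  ... | paired _ fo la | isolated fb lb =
    ⊥-elim (isolated-unnamed fb fo (sym (cong proj₁ (trans (sym la) (trans eq (cong dual lb))))))
  ... | paired {o} {m} fa fo la | paired {o'} {m'} fb fo' lb
    with key-dual⁻¹ {o = o} {m} {o'} {m'} (trans (sym la) (trans eq (cong dual lb)))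
  ...   | inj₁ refl = close-path (neighbour-adjacent fa) (neighbour-adjacent fo) (flip (neighbour-adjacent fb))
  ...   | inj₂ refl = close-path (neighbour-adjacent fa) (flip (neighbour-adjacent fo')) (flip (neighbour-adjacent fb))

  labelling-exact : ∀ a b → ⌊ lab a ≟P dual (lab b) ⌋ ≡ D a b
  labelling-exact a b with lab a ≟P dual (lab b) | D a b in ab
  ... | yes named | true  = refl
  ... | yes named | false = ⊥-elim (true≢false (trans (sym (dual⇒adjacent named)) ab))
  ... | no unnamed | true  = ⊥-elim (unnamed (adjacent⇒dual ab))
  ... | no _      | false = refl

module Realising {n} (E : Rel n) (lab : Fin n → Pred) where

  record Realisation (S : List (Fin n)) (O : Set) (c : O → O → Bool) (l : O → Pred) : Set where
    field
      vertex    : O → Fin n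
      vertex∈   : ∀ i → vertex i ∈ S
      injective : ∀ {i j} → vertex i ≡ vertex j → i ≡ j
      onto      : ∀ {x} → x ∈ S → ∃ λ i → vertex i ≡ x
      edges     : ∀ i j → c i j ≡ E (vertex i) (vertex j)
      labels    : ∀ i → l i ≡ lab (vertex i)

  Realises : List (Fin n) → Prop → Set
  Realises S φ = Realisation S (Fin (size φ)) (conj φ) (label φ)

  reindex : ∀ {S O O' c l} (f : O' → O) (g : O → O') → (∀ i → g (f i) ≡ i) → (∀ o → f (g o) ≡ o) →
            Realisation S O c l → Realisation S O' (λ i j → c (f i) (f j)) (l ∘ f)
  reindex f g gf fg r = record
    { vertex    = vertex ∘ f
    ; vertex∈   = vertex∈ ∘ f
    ; injective = λ {i} {j} e → trans (sym (gf i)) (trans (cong g (injective e)) (gf j))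
    ; onto      = λ x∈ → g (proj₁ (onto x∈)) , trans (cong vertex (fg _)) (proj₂ (onto x∈))
    ; edges     = λ i j → edges (f i) (f j)
    ; labels    = labels ∘ f }
    where open Realisation r

  realiseAtom : ∀ {v} → E v v ≡ false → Realises (v ∷ []) (atom (lab v))
  realiseAtom {v} vv = record
    { vertex    = λ _ → v
    ; vertex∈   = λ _ → here refl
    ; injective = λ { {zero} {zero} _ → refl }
    ; onto      = λ { (here refl) → zero , refl ; (there ()) }
    ; edges     = λ _ _ → sym vv
    ; labels    = λ _ → refl }

  combine : ∀ {S φ ψ} → Symmetric E → (sp : Split E S) →
            Realises (side sp true) φ → Realises (side sp false) ψ →
            Realisation S (Fin (size φ) ⊎ Fin (size ψ)) (conjBin (between sp) φ ψ) [ label φ , label ψ ]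
  combine {S} {φ} {ψ} E-sym sp rφ rψ = record
    { vertex    = vertex
    ; vertex∈   = vertex∈
    ; injective = injective
    ; onto      = onto
    ; edges     = edges
    ; labels    = λ { (inj₁ i) → A.labels i ; (inj₂ j) → B.labels j } }
    where
    module A = Realisation rφ
    module B = Realisation rψ

    vertex : Fin (size φ) ⊎ Fin (size ψ) → Fin n
    vertex = [ A.vertex , B.vertex ]

    vertex∈ : ∀ i → vertex i ∈ S
    vertex∈ (inj₁ i) = proj₁ (∈-side⁻ sp (A.vertex∈ i))
    vertex∈ (inj₂ j) = proj₁ (∈-side⁻ sp (B.vertex∈ j))

    apart : ∀ i j → part sp (A.vertex i) ≢ part sp (B.vertex j)
    apart i j e = true≢false (trans (sym (proj₂ (∈-side⁻ sp (A.vertex∈ i))))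
                            (trans e (proj₂ (∈-side⁻ sp (B.vertex∈ j)))))

    injective : ∀ {i j} → vertex i ≡ vertex j → i ≡ j
    injective {inj₁ i} {inj₁ j} e = cong inj₁ (A.injective e)
    injective {inj₂ i} {inj₂ j} e = cong inj₂ (B.injective e)
    injective {inj₁ i} {inj₂ j} e = ⊥-elim (apart i j (cong (part sp) e))
    injective {inj₂ i} {inj₁ j} e = ⊥-elim (apart j i (cong (part sp) (sym e)))

    onto : ∀ {x} → x ∈ S → ∃ λ i → vertex i ≡ x
    onto {x} x∈ with part sp x in colour
    ... | true  = let i , vi = A.onto (∈-side⁺ sp x∈ colour) in inj₁ i , vi
    ... | false = let j , vj = B.onto (∈-side⁺ sp x∈ colour) in inj₂ j , vj

    edges : ∀ i j → conjBin (between sp) φ ψ i j ≡ E (vertex i) (vertex j)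
    edges (inj₁ i) (inj₁ j) = A.edges i j
    edges (inj₂ i) (inj₂ j) = B.edges i j
    edges (inj₁ i) (inj₂ j) = sym (uniform sp (vertex∈ (inj₁ i)) (vertex∈ (inj₂ j)) (apart i j))
    edges (inj₂ i) (inj₁ j) =
      sym (trans (E-sym _ _) (uniform sp (vertex∈ (inj₁ j)) (vertex∈ (inj₂ i)) (apart j i)))

  node : Bool → Prop → Prop → Prop
  node true  = _∧_
  node false = _∨_

  concatenate : ∀ {S m k c l} → Realisation S (Fin m ⊎ Fin k) c l →
                Realisation S (Fin (m + k)) (λ i j → c (splitAt m i) (splitAt m j)) (l ∘ splitAt m)
  concatenate {m = m} {k} = reindex (splitAt m) (join m k) (join-splitAt m k) (splitAt-join m k)

  realiseNode : ∀ {S φ ψ} b →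
                Realisation S (Fin (size φ) ⊎ Fin (size ψ)) (conjBin b φ ψ) [ label φ , label ψ ] →
                Realises S (node b φ ψ)
  realiseNode true  = concatenate
  realiseNode false = concatenate

  realiseSplit : ∀ {S} → Symmetric E → (sp : Split E S) → (∀ c → ∃ (Realises (side sp c))) → ∃ (Realises S)
  realiseSplit E-sym sp sub with sub true | sub false
  ... | φ , rφ | ψ , rψ = node (between sp) φ ψ , realiseNode (between sp) (combine E-sym sp rφ rψ)

  realise : Symmetric E → Irreflexive E → NoP4 E →
            ∀ {S x} → Unique S → x ∈ S → Acc _<_ (length S) → ∃ (Realises S)
  realise _ E-irrefl _ {v ∷ []} _ _ _ = atom (lab v) , realiseAtom (E-irrefl v)
  realise E-sym E-irrefl noP4 {v ∷ w ∷ rest} distinct _ (acc smaller) =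
    realiseSplit E-sym sp λ c →
      realise E-sym E-irrefl noP4 (side-unique sp distinct c) (proj₂ (side-inhabited sp c))
              (smaller (side-shorter sp c))
    where
    sp : Split E (v ∷ w ∷ rest)
    sp = cographSplit E-sym noP4 distinct

open Realising using (Realisation; Realises; realise)

realisation⇒≅ : ∀ G {lab φ} → (∀ a b → ⌊ lab a ≟P dual (lab b) ⌋ ≡ RawDG.Δ G a b) →
                Realises (RawDG.E G) lab (allFin (RawDG.n G)) φ → G ≅ 𝒟 φ
realisation⇒≅ G {lab} {φ} exact r = record
  { iso    = mk⤖ ((λ e → trans (sym (vertex-occ _)) (trans (cong vertex e) (vertex-occ _))) ,
                  λ i → vertex i , λ { refl → injective (vertex-occ (vertex i)) })
  ; pres-E = λ a b → trans (edges (occ a) (occ b)) (cong₂ E (vertex-occ a) (vertex-occ b))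
  ; pres-Δ = λ a b → trans (cong₂ (λ p q → ⌊ p ≟P dual q ⌋) (label-occ a) (label-occ b)) (exact a b) }
  where
  open RawDG G
  open Realisation r

  occ : Fin n → Fin (size φ)
  occ a = proj₁ (onto (∈-allFin a))

  vertex-occ : ∀ a → vertex (occ a) ≡ a
  vertex-occ a = proj₂ (onto (∈-allFin a))

  label-occ : ∀ a → label φ (occ a) ≡ lab a
  label-occ a = trans (labels (occ a)) (cong lab (vertex-occ a))

mainTheorem18 : (G : DualizingGraph) → Σ Prop (λ φ → proj₁ G ≅ 𝒟 φ)
mainTheorem18 (G , dualizing) =
  proj₁ realised , realisation⇒≅ G {lab} {proj₁ realised} labelling-exact (proj₂ realised)
  where
  open RawDG G
  open IsDualizingGraph dualizing
  open Labelling Δ Δ-sym Δ-irrefl (cograph⇒noP4 Δ-cograph) (triangleFree⇒noTriangle Δ-triangleFree)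
    using (lab; labelling-exact)

  realised : ∃ (Realises E lab (allFin n))
  realised = realise E lab E-sym E-irrefl (cograph⇒noP4 E-cograph)
                     (allFin⁺ n) (∈-allFin (fromℕ< nonempty)) (<-wellFounded _)
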